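{- Let $a_1,\ldots,a_k\in[n-1]$ with induced blocks $\mathscr{B}_1,\ldots,\mathscr{B}_t$, and let $J=\mathfrak{S}_{\mathscr{B}_1}\times\cdots\times\mathfrak{S}_{\mathscr{B}_t}$ act on a conjugacy class $C_{\boldsymbol{\lambda}}$ of $\mathfrak{S}_{n,r}$ by $\pi\cdot(\omega,\tau)=(\pi,\mathbf{0})(\omega,\tau)(\pi,\mathbf{0})^{ -1}$, where $\mathbf{0}$ is the zero coloring. If $C_{\boldsymbol{\lambda}}$ contains no cycles of lengths $1,2,\ldots,2k$, then each orbit under this action has size $|J|=\prod_{i=1}^t|\mathscr{B}_i|!$. Furthermore, there is a unique element in each orbit that has descents at $a_1,\ldots,a_k$.
   Context: $\mathfrak{S}_{n,r}$ is the set of pairs $(\omega,\tau)$, $\omega\in\mathfrak{S}_n$, $\tau:[n]\to\mathbb{Z}_r$ (colors $0,\ldots,r-1$), with product $(\omega_1,\tau_1)(\omega_2,\tau_2)=(\omega_1\omega_2,\tau_1\circ\omega_2+\tau_2)$. Order symbols $i^c$ by $1^0<\cdots<n^0<1^1<\cdots<n^1<\cdots<1^{r-1}<\cdots<n^{r-1}$. An index $i\in[n]$ is a descent of $(\omega,\tau)$ if $\omega(i)^{\tau(i)}>\omega(i+1)^{\tau(i+1)}$, with convention $\omega(n+1)=n+1$, $\tau(n+1)=0$. The Young subgroup generated by $a_1,\ldots,a_k$ is the subgroup of $\mathfrak{S}_n$ generated by the transpositions $(a_i,a_i+1)$ with $a_i\ne n$; the induced blocks $\mathscr{B}_1,\ldots,\mathscr{B}_t$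 are its orbits on $[n]$, and $\mathfrak{S}_{\mathscr{B}}$ denotes the permutations of $\mathscr{B}$. For a cycle $(i_1\cdots i_\ell)$ of $\omega$, its length is $\ell$ and its color is $\sum_h\tau(i_h)\in\mathbb{Z}_r$; the cycle type is $\boldsymbol{\lambda}=(\lambda^0,\ldots,\lambda^{r-1})$ with $\lambda^j$ listing the lengths of cycles of color $j$; conjugacy classes are the sets $C_{\boldsymbol{\lambda}}$ of elements with a given cycle type, and "no cycles of lengths $1,\ldots,m$" means no part of any $\lambda^j$ lies in $\{1,\ldots,m\}$. -}

module Defs where

open import Data.Nat using (ℕ; zero; suc; _+_; _*_; _∸_; _≤_; _<_; NonZero; >-nonZero⁻¹)
open import Data.Nat.DivMod using (_%_; m%n<n)
open import Data.Fin using (Fin; toℕ; fromℕ<)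
open import Data.Fin.Permutation using (Permutation′; _⟨$⟩ʳ_; _⟨$⟩ˡ_; _∘ₚ_; flip)
open import Data.Product using (Σ; _×_; _,_)
open import Data.Sum using (_⊎_)
open import Data.List using (List; [])
open import Data.List.Membership.Propositional using (_∈_)
open import Data.List.Relation.Unary.All using (All)
open import Relation.Binary.PropositionalEquality using (_≡_)
open import Relation.Nullary using (¬_)

module _ {r : ℕ} .{{_ : NonZero r}} where

  0ᶜ : Fin r
  0ᶜ = fromℕ< (>-nonZero⁻¹ r)

  _+ᶜ_ : Fin r → Fin r → Fin r
  a +ᶜ b = fromℕ< (m%n<n (toℕ a + toℕ b) r)

  -ᶜ_ : Fin r → Fin r
  -ᶜ a = fromℕ< (m%n<n (r ∸ toℕ a) r)

-- The colored permutation group 𝔖_{n,r}.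
-- Positions/values 1..n are represented by Fin n (i.e. 0..n-1).

record ColPerm (n r : ℕ) : Set where
  constructor ⟨_,_⟩
  field
    ω : Permutation′ n
    τ : Fin n → Fin r
open ColPerm public

_≈ₚ_ : ∀ {n} → Permutation′ n → Permutation′ n → Set
π ≈ₚ ρ = ∀ i → π ⟨$⟩ʳ i ≡ ρ ⟨$⟩ʳ i

_≈_ : ∀ {n r} → ColPerm n r → ColPerm n r → Set
x ≈ y = (ω x ≈ₚ ω y) × (∀ i → τ x i ≡ τ y i)

module _ {n r : ℕ} .{{_ : NonZero r}} where

  -- (ω₁,τ₁)(ω₂,τ₂) = (ω₁ω₂, τ₁∘ω₂ + τ₂), where ω₁ω₂ = ω₁ ∘ ω₂ (apply ω₂ first);
  -- note stdlib's  π₁ ∘ₚ π₂  applies π₁ first.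
  _·_ : ColPerm n r → ColPerm n r → ColPerm n r
  ⟨ ω₁ , τ₁ ⟩ · ⟨ ω₂ , τ₂ ⟩ = ⟨ ω₂ ∘ₚ ω₁ , (λ i → τ₁ (ω₂ ⟨$⟩ʳ i) +ᶜ τ₂ i) ⟩

  _⁻¹ : ColPerm n r → ColPerm n r
  ⟨ ω₁ , τ₁ ⟩ ⁻¹ = ⟨ flip ω₁ , (λ i → -ᶜ τ₁ (ω₁ ⟨$⟩ˡ i)) ⟩

  uncolored : Permutation′ n → ColPerm n r
  uncolored π = ⟨ π , (λ _ → 0ᶜ) ⟩

  act : Permutation′ n → ColPerm n r → ColPerm n r
  act π x = (uncolored π · x) · (uncolored π ⁻¹)

_^_$_ : ∀ {n} → Permutation′ n → ℕ → Fin n → Fin n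
ω ^ zero $ i = i
ω ^ suc m $ i = ω ⟨$⟩ʳ (ω ^ m $ i)

HasCycleOfLength : ∀ {n} → Permutation′ n → ℕ → Set
HasCycleOfLength {n} ω ℓ =
  Σ (Fin n) λ i → 1 ≤ ℓ × (ω ^ ℓ $ i) ≡ i × (∀ m → 1 ≤ m → m < ℓ → ¬ ((ω ^ m $ i) ≡ i))

NoCyclesUpTo : ∀ {n r} → ℕ → ColPerm n r → Set
NoCyclesUpTo m x = ∀ ℓ → 1 ≤ ℓ → ℓ ≤ m → ¬ HasCycleOfLength (ω x) ℓ

-- positions p, q ∈ [n] (1-indexed) lie in the same induced block iff every
-- m with min(p,q) ≤ m < max(p,q) is one of the generators a_i
-- (the orbits of ⟨(a_i, a_i+1)⟩ are the intervals glued along the a_i)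
SameBlock : List ℕ → ℕ → ℕ → Set
SameBlock as p q = ∀ m → ((p ≤ m × m < q) ⊎ (q ≤ m × m < p)) → m ∈ as

InJ : ∀ {n} → List ℕ → Permutation′ n → Set
InJ as π = ∀ i → SameBlock as (suc (toℕ (π ⟨$⟩ʳ i))) (suc (toℕ i))

-- lexicographic order on symbols v^c, encoded as (c , v):
-- 1^0 < ⋯ < n^0 < 1^1 < ⋯ ; (c , v) > (d , w)
_>ˢ_ : ℕ × ℕ → ℕ × ℕ → Set
(c , v) >ˢ (d , w) = (d < c) ⊎ (c ≡ d × w < v)

-- the symbol ω(j)^{τ(j)} at 1-indexed position j = suc p, with ω(n+1)^{τ(n+1)} = (n+1)^0
symbolAt : ∀ {n r} → ColPerm n r → ℕ → ℕ × ℕ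
symbolAt {n} x p with p Data.Nat.<? n
... | Relation.Nullary.yes p<n = toℕ (τ x (fromℕ< p<n)) , suc (toℕ (ω x ⟨$⟩ʳ fromℕ< p<n))
... | Relation.Nullary.no _ = 0 , suc n

IsDescent : ∀ {n r} → ColPerm n r → ℕ → Set
IsDescent x i = symbolAt x (i ∸ 1) >ˢ symbolAt x i

HasDescentsAt : ∀ {n r} → List ℕ → ColPerm n r → Set
HasDescentsAt as x = All (IsDescent x) as

-- Write x = (w, τ) and c i for the colour of i. In π · x the element i sits at position π i with the
-- symbol (π (w i))^(c i). Comparing two such symbols inside a block involves π only through the
-- relative position of w i and w j, and this is fixed in advance unless w i and w j share a block,
-- since π preserves the order of different blocks. Unwinding this along w defines an order ≻ on each
-- block that does not mention π, and π · x has descents at all generators exactly when π lists every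
-- block in ≻-decreasing order. The unwinding needs at most 2k steps: a w-orbit staying in non-singleton
-- blocks for 2k + 1 steps stays among at most 2k positions and closes a cycle of length ≤ 2k. So ≻ is
-- total, sorting the blocks produces the element with the descents, and it is unique. Freeness is the
-- same orbit argument: an element of J fixing x commutes with w, so each point it moves drags its
-- whole orbit through non-singleton blocks.

module Submission where

open import Defs
open import Data.Empty using (⊥-elim)
open import Data.Fin as Fin using (Fin; Fin′; toℕ; fromℕ<; inject)
open import Data.Fin.Permutation
  using (Permutation′; _⟨$⟩ʳ_; _⟨$⟩ˡ_; _∘ₚ_; transpose; flip; id; inverseˡ; inverseʳ)
import Data.Fin.Permutation.Components as PC
open import Data.Fin.Properties
  using (toℕ-injective; suc-injective; toℕ-inject; toℕ<n; toℕ-fromℕ<; fromℕ<-toℕ; pigeonhole; any?;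
         ¬∀⟶∃¬-smallest)
open import Data.List using (List; length; _++_; map; lookup)
open import Data.List.Membership.Propositional using (_∈_)
open import Data.List.Membership.Propositional.Properties using (∈-++⁺ˡ; ∈-++⁺ʳ; ∈-map⁺)
open import Data.List.Properties using (length-++; length-map)
open import Data.List.Relation.Unary.All as All using (All)
open import Data.List.Relation.Unary.Any using (index)
open import Data.List.Relation.Unary.Any.Properties using (lookup-index)
open import Data.Nat as ℕ using (ℕ; zero; suc; _+_; _*_; _∸_; _≤_; _<_; _≤?_; _<?_; s≤s; NonZero; pred)
open import Data.List.Membership.DecPropositional ℕ._≟_ using (_∈?_)
open import Data.Nat.DivMod using (_%_; m<n⇒m%n≡m; n%n≡0)
open import Data.Nat.Induction using (<-rec)
open import Data.Nat.Properties
  using (≤-refl; ≤-reflexive; ≤-trans; ≤-antisym; ≤-<-trans; <-≤-trans; <-trans; <-irrefl; <-asym; <-cmp;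
         <⇒≤; <⇒≢; <⇒≱; >⇒≢; ≰⇒>; ≮⇒≥; n<1+n; n≤1+n; m<1+n⇒m≤n; m<1+n⇒m<n∨m≡n; m≤n⇒m≤o+n; m≤n⇒m≤n+o;
         m<n⇒0<n∸m; m∸n≤m;
         m+[n∸m]≡n; +-identityʳ; allUpTo?)
open import Data.Product using (Σ; ∃; ∃₂; _×_; _,_; proj₁; proj₂)
open import Data.Sum using (_⊎_; inj₁; inj₂)
open import Function using (_∘_)
open import Function.Bundles using (Injection)
open import Function.Properties.Inverse using (↔⇒↣)
open import Level using (0ℓ)
open import Relation.Binary using (Rel; Transitive; IsDecEquivalence; tri<; tri≈; tri>)
open import Relation.Binary.PropositionalEquality
  using (_≡_; _≢_; refl; sym; trans; cong; subst; subst₂; module ≡-Reasoning)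
open import Relation.Nullary using (¬_; Dec; yes; no; contradiction)
open import Relation.Nullary.Decidable using (_×-dec_; _⊎-dec_; _→-dec_; map′)
open import Relation.Unary using (Pred; Decidable)

open ≡-Reasoning

-- Blocks of the Young subgroup

module _ {as : List ℕ} where

  SameBlock-refl : ∀ p → SameBlock as p p
  SameBlock-refl p m (inj₁ (p≤m , m<p)) = contradiction (≤-<-trans p≤m m<p) (<-irrefl refl)
  SameBlock-refl p m (inj₂ (p≤m , m<p)) = contradiction (≤-<-trans p≤m m<p) (<-irrefl refl)

  SameBlock-sym : ∀ {p q} → SameBlock as p q → SameBlock as q p
  SameBlock-sym p~q m (inj₁ range) = p~q m (inj₂ range)
  SameBlock-sym p~q m (inj₂ range) = p~q m (inj₁ range)

  SameBlock-trans : ∀ {p q s} → SameBlock as p q → SameBlock as q s → SameBlock as p s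
  SameBlock-trans {q = q} p~q q~s m (inj₁ (p≤m , m<s)) with m <? q
  ... | yes m<q = p~q m (inj₁ (p≤m , m<q))
  ... | no m≮q = q~s m (inj₁ (≮⇒≥ m≮q , m<s))
  SameBlock-trans {q = q} p~q q~s m (inj₂ (s≤m , m<p)) with m <? q
  ... | yes m<q = q~s m (inj₂ (s≤m , m<q))
  ... | no m≮q = p~q m (inj₂ (≮⇒≥ m≮q , m<p))

  SameBlock-shrink : ∀ {p q s} → p ≤ q → q ≤ s → SameBlock as p s → SameBlock as p q
  SameBlock-shrink p≤q q≤s p~s m (inj₁ (p≤m , m<q)) = p~s m (inj₁ (p≤m , <-≤-trans m<q q≤s))
  SameBlock-shrink p≤q q≤s p~s m (inj₂ (q≤m , m<p)) =
    contradiction (≤-<-trans (≤-trans p≤q q≤m) m<p) (<-irrefl refl)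

  -- Blocks are intervals, so two different blocks are ordered as wholes.
  SameBlock-separated : ∀ {p q p′ q′} → ¬ SameBlock as p q → p < q →
                        SameBlock as p p′ → SameBlock as q q′ → p′ < q′
  SameBlock-separated {p} {q} {p′} {q′} p≁q p<q p~p′ q~q′ with q′ ≤? p′
  ... | no q′≰p′ = ≰⇒> q′≰p′
  ... | yes q′≤p′ = contradiction p~q p≁q
    where
    p~q : SameBlock as p q
    p~q m (inj₁ (p≤m , m<q)) with m <? p′
    ... | yes m<p′ = p~p′ m (inj₁ (p≤m , m<p′))
    ... | no m≮p′ = q~q′ m (inj₂ (≤-trans q′≤p′ (≮⇒≥ m≮p′) , m<q))
    p~q m (inj₂ (q≤m , m<p)) = contradiction (≤-<-trans q≤m m<p) (<-asym p<q)

  SameBlock-generator : ∀ {a} → a ∈ as → SameBlock as a (suc a)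
  SameBlock-generator a∈as m (inj₁ (a≤m , m<1+a)) = subst (_∈ as) (≤-antisym a≤m (ℕ.s≤s⁻¹ m<1+a)) a∈as
  SameBlock-generator {a} a∈as m (inj₂ (1+a≤m , m<a)) = contradiction (≤-<-trans 1+a≤m m<a) (<-asym (n<1+n a))

sameBlock? : ∀ as p q → Dec (SameBlock as p q)
sameBlock? as p q = map′ fromBelowSum (λ h _ → h _) (allUpTo? inRange→∈? (p + q))
  where
  InRange→∈ : ℕ → Set
  InRange→∈ m = (p ≤ m × m < q) ⊎ (q ≤ m × m < p) → m ∈ as

  inRange→∈? : ∀ m → Dec (InRange→∈ m)
  inRange→∈? m = ((p ≤? m ×-dec m <? q) ⊎-dec (q ≤? m ×-dec m <? p)) →-dec (m ∈? as)

  bounded : ∀ {m} → (p ≤ m × m < q) ⊎ (q ≤ m × m < p) → m < p + q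
  bounded (inj₁ (_ , m<q)) = m≤n⇒m≤o+n p m<q
  bounded (inj₂ (_ , m<p)) = m≤n⇒m≤n+o q m<p

  fromBelowSum : (∀ {m} → m < p + q → InRange→∈ m) → SameBlock as p q
  fromBelowSum h m range = h (bounded range) range

-- Contains every 0-indexed position of a non-singleton block: the generator a joins the 1-indexed
-- positions a and a + 1.
nonSingletonPositions : List ℕ → List ℕ
nonSingletonPositions as = as ++ map pred as

length-nonSingletonPositions : ∀ as → length (nonSingletonPositions as) ≡ 2 * length as
length-nonSingletonPositions as =
  trans (length-++ as) (cong (length as +_) (trans (length-map pred as) (sym (+-identityʳ _))))

SameBlock⇒nonSingleton : ∀ {as s t} → SameBlock as (suc s) (suc t) → s ≢ t → t ∈ nonSingletonPositions as
SameBlock⇒nonSingleton {as} {s} {t} s~t s≢t with <-cmp t s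
... | tri< t<s _ _ = ∈-++⁺ʳ as (∈-map⁺ pred (s~t (suc t) (inj₂ (≤-refl , s≤s t<s))))
... | tri≈ _ t≡s _ = contradiction (sym t≡s) s≢t
... | tri> _ _ s<t = ∈-++⁺ˡ (s~t t (inj₁ (s<t , n<1+n t)))

-- Orbits of a permutation

module _ {n : ℕ} (w : Permutation′ n) where

  ^-+ : ∀ m d i → w ^ (m + d) $ i ≡ w ^ m $ (w ^ d $ i)
  ^-+ zero d i = refl
  ^-+ (suc m) d i = cong (w ⟨$⟩ʳ_) (^-+ m d i)

  ^-suc′ : ∀ m i → w ^ suc m $ i ≡ w ^ m $ (w ⟨$⟩ʳ i)
  ^-suc′ zero i = refl
  ^-suc′ (suc m) i = cong (w ⟨$⟩ʳ_) (^-suc′ m i)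

  ^-injective : ∀ m {i j} → w ^ m $ i ≡ w ^ m $ j → i ≡ j
  ^-injective zero eq = eq
  ^-injective (suc m) eq = ^-injective m (Injection.injective (↔⇒↣ w) eq)

  period⇒HasCycleOfLength≤ : ∀ d {i} → 1 ≤ d → w ^ d $ i ≡ i → ∃ λ ℓ → ℓ ≤ d × HasCycleOfLength w ℓ
  period⇒HasCycleOfLength≤ = <-rec Claim shortenPeriod
    where
    Claim : ℕ → Set
    Claim d = ∀ {i} → 1 ≤ d → w ^ d $ i ≡ i → ∃ λ ℓ → ℓ ≤ d × HasCycleOfLength w ℓ

    shortenPeriod : ∀ d → (∀ {e} → e < d → Claim e) → Claim d
    shortenPeriod d rec {i} 1≤d wᵈi≡i
      with any? (λ (e : Fin d) → 1 ≤? toℕ e ×-dec (w ^ toℕ e $ i Fin.≟ i))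
    ... | yes (e , 1≤e , wᵉi≡i) with rec (toℕ<n e) 1≤e wᵉi≡i
    ...   | ℓ , ℓ≤e , cycle = ℓ , ≤-trans ℓ≤e (<⇒≤ (toℕ<n e)) , cycle
    shortenPeriod d rec {i} 1≤d wᵈi≡i | no noShorterPeriod = d , ≤-refl , i , 1≤d , wᵈi≡i , minimal
      where
      minimal : ∀ m → 1 ≤ m → m < d → ¬ (w ^ m $ i ≡ i)
      minimal m 1≤m m<d wᵐi≡i = noShorterPeriod (fromℕ< m<d ,
        subst (λ k → 1 ≤ k × w ^ k $ i ≡ i) (sym (toℕ-fromℕ< m<d)) (1≤m , wᵐi≡i))

  orbit-leaves : ∀ (L : List ℕ) K → length L ≤ K →
                 (∀ ℓ → 1 ≤ ℓ → ℓ ≤ K → ¬ HasCycleOfLength w ℓ) →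
                 ∀ i → ¬ (∀ m → m ≤ K → toℕ (w ^ m $ i) ∈ L)
  orbit-leaves L K |L|≤K noCycle i inL = collision⇒⊥ (pigeonhole (s≤s |L|≤K) (index ∘ visit))
    where
    visit : (m : Fin (suc K)) → toℕ (w ^ toℕ m $ i) ∈ L
    visit m = inL (toℕ m) (m<1+n⇒m≤n (toℕ<n m))

    collision⇒⊥ : ¬ ∃₂ (λ a b → a Fin.< b × index (visit a) ≡ index (visit b))
    collision⇒⊥ (a , b , a<b , sameIndex) =
      shortCycle⇒⊥ (period⇒HasCycleOfLength≤ d (m<n⇒0<n∸m a<b) period)
      where
      d : ℕ
      d = toℕ b ∸ toℕ a

      wᵃi≡wᵇi : w ^ toℕ a $ i ≡ w ^ toℕ b $ i
      wᵃi≡wᵇi = toℕ-injective (begin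
        toℕ (w ^ toℕ a $ i)        ≡⟨ lookup-index (visit a) ⟩
        lookup L (index (visit a)) ≡⟨ cong (lookup L) sameIndex ⟩
        lookup L (index (visit b)) ≡⟨ lookup-index (visit b) ⟨
        toℕ (w ^ toℕ b $ i)        ∎)

      period : w ^ d $ i ≡ i
      period = ^-injective (toℕ a) (sym (begin
        w ^ toℕ a $ i           ≡⟨ wᵃi≡wᵇi ⟩
        w ^ toℕ b $ i           ≡⟨ cong (λ k → w ^ k $ i) (m+[n∸m]≡n (<⇒≤ a<b)) ⟨
        w ^ (toℕ a + d) $ i     ≡⟨ ^-+ (toℕ a) d i ⟩
        w ^ toℕ a $ (w ^ d $ i) ∎))

      d≤K : d ≤ K
      d≤K = ≤-trans (m∸n≤m (toℕ b) (toℕ a)) (m<1+n⇒m≤n (toℕ<n b))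

      shortCycle⇒⊥ : ¬ ∃ (λ ℓ → ℓ ≤ d × HasCycleOfLength w ℓ)
      shortCycle⇒⊥ (ℓ , ℓ≤d , cycle) = noCycle ℓ (proj₁ (proj₂ cycle)) (≤-trans ℓ≤d d≤K) cycle

-- Sorting within blocks

empty⊎greatest : ∀ {n} (P : Pred (Fin n) 0ℓ) → Decidable P → {_≻_ : Rel (Fin n) 0ℓ} → Transitive _≻_ →
                 (∀ {i j} → P i → P j → i ≢ j → i ≻ j ⊎ j ≻ i) →
                 (∀ i → ¬ P i) ⊎ ∃ λ m → P m × (∀ v → P v → v ≢ m → m ≻ v)
empty⊎greatest {zero} P P? ≻-trans ≻-total = inj₁ λ ()
empty⊎greatest {suc n} P P? {_≻_} ≻-trans ≻-total
  with empty⊎greatest (P ∘ Fin.suc) (P? ∘ Fin.suc) {λ a b → Fin.suc a ≻ Fin.suc b} ≻-trans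
                      (λ Pi Pj i≢j → ≻-total Pi Pj (i≢j ∘ suc-injective)) | P? Fin.zero
... | inj₁ none | no ¬P0 = inj₁ λ { Fin.zero → ¬P0 ; (Fin.suc i) → none i }
... | inj₁ none | yes P0 = inj₂ (Fin.zero , P0 , λ
  { Fin.zero _ 0≢0 → contradiction refl 0≢0
  ; (Fin.suc v) Pv _ → contradiction Pv (none v) })
... | inj₂ (m , Pm , top) | no ¬P0 = inj₂ (Fin.suc m , Pm , λ
  { Fin.zero P0 _ → contradiction P0 ¬P0
  ; (Fin.suc v) Pv v≢m → top v Pv (v≢m ∘ cong Fin.suc) })
... | inj₂ (m , Pm , top) | yes P0 with ≻-total P0 Pm (λ ())
...   | inj₂ m≻0 = inj₂ (Fin.suc m , Pm , λ
  { Fin.zero _ _ → m≻0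
  ; (Fin.suc v) Pv v≢m → top v Pv (v≢m ∘ cong Fin.suc) })
...   | inj₁ 0≻m = inj₂ (Fin.zero , P0 , λ
  { Fin.zero _ 0≢0 → contradiction refl 0≢0
  ; (Fin.suc v) Pv _ → 0≻suc v Pv })
  where
  0≻suc : ∀ v → P (Fin.suc v) → Fin.zero ≻ Fin.suc v
  0≻suc v Pv with v Fin.≟ m
  ... | yes refl = 0≻m
  ... | no v≢m = ≻-trans 0≻m (top v Pv v≢m)

transpose-cases : ∀ {n} (i j k : Fin n) → (k ≡ i × PC.transpose i j k ≡ j)
                  ⊎ (k ≢ i × k ≡ j × PC.transpose i j k ≡ i) ⊎ (k ≢ i × k ≢ j × PC.transpose i j k ≡ k)
transpose-cases i j k with k Fin.≟ i
... | yes k≡i = inj₁ (k≡i , refl)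
... | no k≢i with k Fin.≟ j
...   | yes k≡j = inj₂ (inj₁ (k≢i , k≡j , refl))
...   | no k≢j = inj₂ (inj₂ (k≢i , k≢j , refl))

module BlockSort {n : ℕ} {_∼_ : Rel (Fin n) 0ℓ} (∼-isDecEquivalence : IsDecEquivalence _∼_)
                 {_≻_ : Rel (Fin n) 0ℓ} (≻-trans : Transitive _≻_)
                 (≻-total : ∀ {i j} → i ≢ j → i ∼ j → i ≻ j ⊎ j ≻ i) where

  open IsDecEquivalence ∼-isDecEquivalence
    renaming (refl to ∼-refl; sym to ∼-sym; trans to ∼-trans; _≟_ to _∼?_)

  SortedBelow : ℕ → Permutation′ n → Set
  SortedBelow p ρ = (∀ u → (ρ ⟨$⟩ʳ u) ∼ u)
                  × (∀ u v → toℕ u < p → toℕ u < toℕ v → u ∼ v → (ρ ⟨$⟩ʳ u) ≻ (ρ ⟨$⟩ʳ v))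

  -- One step of selection sort: move the ≻-greatest remaining element of the block of position p to p.
  module SelectionStep {p : ℕ} (p<n : p < n) (ρ : Permutation′ n) (ρ-sorted : SortedBelow p ρ) where

    open Σ ρ-sorted renaming (proj₁ to ρ∼; proj₂ to sorted)

    P : Fin n
    P = fromℕ< p<n

    toℕ-P : toℕ P ≡ p
    toℕ-P = toℕ-fromℕ< p<n

    Candidate : Fin n → Set
    Candidate v = p ≤ toℕ v × P ∼ v

    candidate-P : Candidate P
    candidate-P = ≤-reflexive (sym toℕ-P) , ∼-refl

    greatest : ∃ λ m → Candidate m × (∀ v → Candidate v → v ≢ m → (ρ ⟨$⟩ʳ m) ≻ (ρ ⟨$⟩ʳ v))
    greatest with empty⊎greatest Candidate (λ v → p ≤? toℕ v ×-dec P ∼? v) ≻-trans total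
      where
      total : ∀ {a b} → Candidate a → Candidate b → a ≢ b →
              (ρ ⟨$⟩ʳ a) ≻ (ρ ⟨$⟩ʳ b) ⊎ (ρ ⟨$⟩ʳ b) ≻ (ρ ⟨$⟩ʳ a)
      total {a} {b} (_ , P∼a) (_ , P∼b) a≢b = ≻-total (a≢b ∘ Injection.injective (↔⇒↣ ρ))
        (∼-trans (ρ∼ a) (∼-trans (∼-trans (∼-sym P∼a) P∼b) (∼-sym (ρ∼ b))))
    ... | inj₁ none = contradiction candidate-P (none P)
    ... | inj₂ m = m

    m : Fin n
    m = proj₁ greatest

    p≤m : p ≤ toℕ m
    p≤m = proj₁ (proj₁ (proj₂ greatest))

    swap : Fin n → Fin n
    swap = PC.transpose P m

    swap∼ : ∀ u → swap u ∼ u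
    swap∼ u with transpose-cases P m u
    ... | inj₁ (refl , swapu≡m) = subst (_∼ P) (sym swapu≡m) (∼-sym (proj₂ (proj₁ (proj₂ greatest))))
    ... | inj₂ (inj₁ (_ , refl , swapu≡P)) = subst (_∼ m) (sym swapu≡P) (proj₂ (proj₁ (proj₂ greatest)))
    ... | inj₂ (inj₂ (_ , _ , swapu≡u)) = subst (_∼ u) (sym swapu≡u) ∼-refl

    swap-fixes-below : ∀ {u : Fin n} → toℕ u < p → swap u ≡ u
    swap-fixes-below {u} u<p with transpose-cases P m u
    ... | inj₁ (refl , _) = contradiction toℕ-P (<⇒≢ u<p)
    ... | inj₂ (inj₁ (_ , refl , _)) = contradiction p≤m (<⇒≱ u<p)
    ... | inj₂ (inj₂ (_ , _ , swapu≡u)) = swapu≡u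

    swap-stays-above : ∀ {u v : Fin n} → toℕ u < p → toℕ u < toℕ v → toℕ u < toℕ (swap v)
    swap-stays-above {u} {v} u<p u<v with transpose-cases P m v
    ... | inj₁ (_ , swapv≡m) = subst (λ k → toℕ u < toℕ k) (sym swapv≡m) (<-≤-trans u<p p≤m)
    ... | inj₂ (inj₁ (_ , _ , swapv≡P)) =
      subst (λ k → toℕ u < toℕ k) (sym swapv≡P) (subst (toℕ u <_) (sym toℕ-P) u<p)
    ... | inj₂ (inj₂ (_ , _ , swapv≡v)) = subst (λ k → toℕ u < toℕ k) (sym swapv≡v) u<v

    ρ′ : Permutation′ n
    ρ′ = transpose P m ∘ₚ ρ

    sortedAt-P : ∀ v → p < toℕ v → P ∼ v → (ρ′ ⟨$⟩ʳ P) ≻ (ρ′ ⟨$⟩ʳ v)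
    sortedAt-P v p<v P∼v with transpose-cases P m P | transpose-cases P m v
    ... | inj₂ (inj₁ (P≢P , _)) | _ = contradiction refl P≢P
    ... | inj₂ (inj₂ (P≢P , _)) | _ = contradiction refl P≢P
    ... | inj₁ (_ , swapP≡m) | inj₁ (refl , _) = contradiction toℕ-P (>⇒≢ p<v)
    ... | inj₁ (_ , swapP≡m) | inj₂ (inj₁ (v≢P , refl , swapv≡P)) =
      subst₂ (λ a b → (ρ ⟨$⟩ʳ a) ≻ (ρ ⟨$⟩ʳ b)) (sym swapP≡m) (sym swapv≡P)
        (proj₂ (proj₂ greatest) P candidate-P (v≢P ∘ sym))
    ... | inj₁ (_ , swapP≡m) | inj₂ (inj₂ (_ , v≢m , swapv≡v)) =
      subst₂ (λ a b → (ρ ⟨$⟩ʳ a) ≻ (ρ ⟨$⟩ʳ b)) (sym swapP≡m) (sym swapv≡v)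
        (proj₂ (proj₂ greatest) v (<⇒≤ p<v , P∼v) v≢m)

    sortedBelow-suc : SortedBelow (suc p) ρ′
    sortedBelow-suc = (λ u → ∼-trans (ρ∼ (swap u)) (swap∼ u)) , sorted′
      where
      sorted′ : ∀ u v → toℕ u < suc p → toℕ u < toℕ v → u ∼ v → (ρ′ ⟨$⟩ʳ u) ≻ (ρ′ ⟨$⟩ʳ v)
      sorted′ u v u≤p u<v u∼v with m<1+n⇒m<n∨m≡n u≤p
      ... | inj₁ u<p = subst (λ k → (ρ ⟨$⟩ʳ k) ≻ (ρ′ ⟨$⟩ʳ v)) (sym (swap-fixes-below u<p))
                         (sorted u (swap v) u<p (swap-stays-above u<p u<v) (∼-trans u∼v (∼-sym (swap∼ v))))
      ... | inj₂ u≡p with toℕ-injective (trans u≡p (sym toℕ-P))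
      ...   | refl = sortedAt-P v (subst (_< toℕ v) u≡p u<v) u∼v

  sortedBelow : ∀ p → p ≤ n → Σ (Permutation′ n) (SortedBelow p)
  sortedBelow zero _ = id , (λ _ → ∼-refl) , (λ _ _ ())
  sortedBelow (suc p) p<n with sortedBelow p (<⇒≤ p<n)
  ... | ρ , ρ-sorted = SelectionStep.ρ′ p<n ρ ρ-sorted , SelectionStep.sortedBelow-suc p<n ρ ρ-sorted

  blockSort : Σ (Permutation′ n) λ ρ →
              (∀ u → (ρ ⟨$⟩ʳ u) ∼ u) × (∀ u v → toℕ u < toℕ v → u ∼ v → (ρ ⟨$⟩ʳ u) ≻ (ρ ⟨$⟩ʳ v))
  blockSort with sortedBelow n ≤-refl
  ... | ρ , ρ∼ , sorted = ρ , ρ∼ , λ u v → sorted u v (toℕ<n u)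

module _ {n : ℕ} (π π′ : Permutation′ n) where

  -- Take the least value u moved by π′ ∘ π⁻¹; the elements sent to u by π and by π′ form an inversion.
  inversion : ∀ k → π ⟨$⟩ʳ k ≢ π′ ⟨$⟩ʳ k →
              ∃₂ λ i i′ → π ⟨$⟩ʳ i ≡ π′ ⟨$⟩ʳ i′
                        × toℕ (π ⟨$⟩ʳ i) < toℕ (π ⟨$⟩ʳ i′) × toℕ (π′ ⟨$⟩ʳ i′) < toℕ (π′ ⟨$⟩ʳ i)
  inversion k πk≢π′k = π ⟨$⟩ˡ u , π′ ⟨$⟩ˡ u , trans (inverseʳ π) (sym (inverseʳ π′))
                     , subst (λ a → toℕ a < toℕ σ⁻¹u) (sym (inverseʳ π)) u<σ⁻¹u
                     , subst (λ a → toℕ a < toℕ (σ u)) (sym (inverseʳ π′)) u<σu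
    where
    σ : Fin n → Fin n
    σ a = π′ ⟨$⟩ʳ (π ⟨$⟩ˡ a)

    σ-injective : ∀ {a b} → σ a ≡ σ b → a ≡ b
    σ-injective = Injection.injective (↔⇒↣ (flip π)) ∘ Injection.injective (↔⇒↣ π′)

    σ-moves-πk : σ (π ⟨$⟩ʳ k) ≢ π ⟨$⟩ʳ k
    σ-moves-πk σπk≡πk = πk≢π′k (trans (sym σπk≡πk) (cong (π′ ⟨$⟩ʳ_) (inverseˡ π)))

    least : ∃ λ u → σ u ≢ u × ((a : Fin′ u) → σ (inject a) ≡ inject a)
    least = ¬∀⟶∃¬-smallest n (λ a → σ a ≡ a) (λ a → σ a Fin.≟ a)
                              (λ fixed → σ-moves-πk (fixed (π ⟨$⟩ʳ k)))

    u : Fin n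
    u = proj₁ least

    σu≢u : σ u ≢ u
    σu≢u = proj₁ (proj₂ least)

    fixes-below : ∀ a → toℕ a < toℕ u → σ a ≡ a
    fixes-below a a<u =
      subst (λ b → σ b ≡ b) (toℕ-injective (trans (toℕ-inject (fromℕ< a<u)) (toℕ-fromℕ< a<u)))
            (proj₂ (proj₂ least) (fromℕ< a<u))

    u<σu : toℕ u < toℕ (σ u)
    u<σu with <-cmp (toℕ u) (toℕ (σ u))
    ... | tri< u<σu _ _ = u<σu
    ... | tri≈ _ u≡σu _ = contradiction (sym (toℕ-injective u≡σu)) σu≢u
    ... | tri> _ _ σu<u = contradiction (σ-injective (fixes-below (σ u) σu<u)) σu≢u

    σ⁻¹u : Fin n
    σ⁻¹u = π ⟨$⟩ʳ (π′ ⟨$⟩ˡ u)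

    σσ⁻¹u : σ σ⁻¹u ≡ u
    σσ⁻¹u = trans (cong (π′ ⟨$⟩ʳ_) (inverseˡ π)) (inverseʳ π′)

    u<σ⁻¹u : toℕ u < toℕ σ⁻¹u
    u<σ⁻¹u with <-cmp (toℕ u) (toℕ σ⁻¹u)
    ... | tri< u<v _ _ = u<v
    ... | tri≈ _ u≡v _ = contradiction (subst (λ a → σ a ≡ u) (sym (toℕ-injective u≡v)) σσ⁻¹u) σu≢u
    ... | tri> _ _ v<u = contradiction (cong toℕ (trans (sym (fixes-below σ⁻¹u v<u)) σσ⁻¹u)) (<⇒≢ v<u)

-- Colored permutations and the conjugation action

module _ {r : ℕ} .{{_ : NonZero r}} where

  toℕ-0ᶜ : toℕ (0ᶜ {r}) ≡ 0
  toℕ-0ᶜ = toℕ-fromℕ< _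

  +ᶜ-identityˡ : ∀ (a : Fin r) → 0ᶜ +ᶜ a ≡ a
  +ᶜ-identityˡ a = toℕ-injective (begin
    toℕ (0ᶜ +ᶜ a)        ≡⟨ toℕ-fromℕ< _ ⟩
    (toℕ 0ᶜ + toℕ a) % r ≡⟨ cong (λ k → (k + toℕ a) % r) toℕ-0ᶜ ⟩
    toℕ a % r            ≡⟨ m<n⇒m%n≡m (toℕ<n a) ⟩
    toℕ a                ∎)

  +ᶜ-identityʳ : ∀ (a : Fin r) → a +ᶜ 0ᶜ ≡ a
  +ᶜ-identityʳ a = toℕ-injective (begin
    toℕ (a +ᶜ 0ᶜ)        ≡⟨ toℕ-fromℕ< _ ⟩
    (toℕ a + toℕ 0ᶜ) % r ≡⟨ cong (λ k → (toℕ a + k) % r) toℕ-0ᶜ ⟩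
    (toℕ a + 0) % r      ≡⟨ cong (_% r) (+-identityʳ (toℕ a)) ⟩
    toℕ a % r            ≡⟨ m<n⇒m%n≡m (toℕ<n a) ⟩
    toℕ a                ∎)

  -ᶜ0ᶜ : -ᶜ 0ᶜ ≡ 0ᶜ {r}
  -ᶜ0ᶜ = toℕ-injective (begin
    toℕ (-ᶜ 0ᶜ)          ≡⟨ toℕ-fromℕ< _ ⟩
    (r ∸ toℕ 0ᶜ) % r     ≡⟨ cong (λ k → (r ∸ k) % r) toℕ-0ᶜ ⟩
    r % r                ≡⟨ n%n≡0 r ⟩
    0                    ≡⟨ toℕ-0ᶜ ⟨
    toℕ 0ᶜ               ∎)

>ˢ-trans : ∀ {a b d} → a >ˢ b → b >ˢ d → a >ˢ d
>ˢ-trans (inj₁ a>b) (inj₁ b>d) = inj₁ (<-trans b>d a>b)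
>ˢ-trans (inj₁ a>b) (inj₂ (refl , _)) = inj₁ a>b
>ˢ-trans (inj₂ (refl , _)) (inj₁ b>d) = inj₁ b>d
>ˢ-trans (inj₂ (refl , a>b)) (inj₂ (refl , b>d)) = inj₂ (refl , <-trans b>d a>b)

>ˢ-asym : ∀ {a b} → a >ˢ b → ¬ b >ˢ a
>ˢ-asym (inj₁ a>b) (inj₁ b>a) = <-asym a>b b>a
>ˢ-asym (inj₁ a>b) (inj₂ (refl , _)) = <-irrefl refl a>b
>ˢ-asym (inj₂ (refl , _)) (inj₁ b>a) = <-irrefl refl b>a
>ˢ-asym (inj₂ (refl , a>b)) (inj₂ (_ , b>a)) = <-asym a>b b>a

descents⇒decreasing : ∀ {n r as} {y : ColPerm n r} → HasDescentsAt as y →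
                      ∀ {p q} → p < q → SameBlock as (suc p) (suc q) → symbolAt y p >ˢ symbolAt y q
descents⇒decreasing {y = y} descents {p} {suc q} p<1+q p~q with m<1+n⇒m<n∨m≡n p<1+q
... | inj₂ refl = All.lookup descents (p~q (suc p) (inj₁ (≤-refl , ≤-refl)))
... | inj₁ p<q =
  >ˢ-trans (descents⇒decreasing {y = y} descents p<q (SameBlock-shrink (s≤s (<⇒≤ p<q)) (n≤1+n _) p~q))
           (All.lookup descents (p~q (suc q) (inj₁ (s≤s (<⇒≤ p<q) , ≤-refl))))

symbolAt-toℕ : ∀ {n r} (y : ColPerm n r) (u : Fin n) →
               symbolAt y (toℕ u) ≡ (toℕ (τ y u) , suc (toℕ (ω y ⟨$⟩ʳ u)))
symbolAt-toℕ {n} y u with toℕ u <? n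
... | yes u<n = cong (λ v → toℕ (τ y v) , suc (toℕ (ω y ⟨$⟩ʳ v))) (fromℕ<-toℕ u u<n)
... | no u≮n = contradiction (toℕ<n u) u≮n

module ConjugationAction {n r : ℕ} .{{_ : NonZero r}} (as : List ℕ) (x : ColPerm n r) where

  w : Permutation′ n
  w = ω x

  W : Fin n → Fin n
  W i = w ⟨$⟩ʳ i

  c : Fin n → ℕ
  c i = toℕ (τ x i)

  infix 4 _∼_
  _∼_ : Rel (Fin n) 0ℓ
  i ∼ j = SameBlock as (suc (toℕ i)) (suc (toℕ j))

  ∼-isDecEquivalence : IsDecEquivalence _∼_
  ∼-isDecEquivalence = record
    { isEquivalence = record { refl = SameBlock-refl _ ; sym = SameBlock-sym ; trans = SameBlock-trans }
    ; _≟_ = λ i j → sameBlock? as (suc (toℕ i)) (suc (toℕ j))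
    }

  open IsDecEquivalence ∼-isDecEquivalence
    using () renaming (refl to ∼-refl; sym to ∼-sym; trans to ∼-trans; _≟_ to _∼?_)

  ∼-separated : ∀ {u v u′ v′} → ¬ u ∼ v → toℕ u < toℕ v → u ∼ u′ → v ∼ v′ → toℕ u′ < toℕ v′
  ∼-separated u≁v u<v u∼u′ v∼v′ = ℕ.s<s⁻¹ (SameBlock-separated u≁v (s≤s u<v) u∼u′ v∼v′)

  InJ-flip : ∀ π → InJ as π → InJ as (flip π)
  InJ-flip π π∈J i = ∼-sym (subst (_∼ (π ⟨$⟩ˡ i)) (inverseʳ π) (π∈J (π ⟨$⟩ˡ i)))

  τ-act : ∀ π j → τ (act π x) j ≡ τ x (π ⟨$⟩ˡ j)
  τ-act π j = begin
    (0ᶜ +ᶜ τ x (π ⟨$⟩ˡ j)) +ᶜ (-ᶜ 0ᶜ) ≡⟨ cong ((0ᶜ +ᶜ τ x (π ⟨$⟩ˡ j)) +ᶜ_) -ᶜ0ᶜ ⟩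
    (0ᶜ +ᶜ τ x (π ⟨$⟩ˡ j)) +ᶜ 0ᶜ      ≡⟨ +ᶜ-identityʳ _ ⟩
    0ᶜ +ᶜ τ x (π ⟨$⟩ˡ j)              ≡⟨ +ᶜ-identityˡ _ ⟩
    τ x (π ⟨$⟩ˡ j)                    ∎

  InJ-resp-∼ : ∀ π → InJ as π → ∀ {i j} → i ∼ j → π ⟨$⟩ʳ i ∼ π ⟨$⟩ʳ j
  InJ-resp-∼ π π∈J {i} {j} i∼j = ∼-trans (π∈J i) (∼-trans i∼j (∼-sym (π∈J j)))

  act-cong : ∀ π π′ → π ≈ₚ π′ → act π x ≈ act π′ x
  act-cong π π′ π≈π′ = (λ j → trans (cong (λ k → π ⟨$⟩ʳ W k) (flip-cong j)) (π≈π′ _))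
                     , (λ j → trans (τ-act π j) (trans (cong (τ x) (flip-cong j)) (sym (τ-act π′ j))))
    where
    flip-cong : ∀ j → π ⟨$⟩ˡ j ≡ π′ ⟨$⟩ˡ j
    flip-cong j = Injection.injective (↔⇒↣ π) (trans (inverseʳ π) (trans (sym (inverseʳ π′)) (sym (π≈π′ _))))

  symbol : Permutation′ n → Fin n → ℕ × ℕ
  symbol π i = c i , suc (toℕ (π ⟨$⟩ʳ W i))

  symbolAt-act : ∀ π i → symbolAt (act π x) (toℕ (π ⟨$⟩ʳ i)) ≡ symbol π i
  symbolAt-act π i = begin
    symbolAt (act π x) (toℕ (π ⟨$⟩ʳ i))
      ≡⟨ symbolAt-toℕ (act π x) (π ⟨$⟩ʳ i) ⟩
    toℕ (τ (act π x) (π ⟨$⟩ʳ i)) , suc (toℕ (π ⟨$⟩ʳ W (π ⟨$⟩ˡ (π ⟨$⟩ʳ i))))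
      ≡⟨ cong (λ a → toℕ a , suc (toℕ (π ⟨$⟩ʳ W (π ⟨$⟩ˡ (π ⟨$⟩ʳ i))))) (τ-act π (π ⟨$⟩ʳ i)) ⟩
    c (π ⟨$⟩ˡ (π ⟨$⟩ʳ i)) , suc (toℕ (π ⟨$⟩ʳ W (π ⟨$⟩ˡ (π ⟨$⟩ʳ i))))
      ≡⟨ cong (λ k → c k , suc (toℕ (π ⟨$⟩ʳ W k))) (inverseˡ π) ⟩
    symbol π i ∎

  -- i ≻[ d ] j: i has to stand before j in its block. For π ∈ J the symbols at π i and π j are
  -- (π (w i))^(c i) and (π (w j))^(c j); colours are compared first, then the blocks of w i and w j,
  -- whose order π cannot change, and inside one block this asks whether w j stands before w i.
  -- The unwinding is cut at depth d.
  _≻⁰_ : Rel (Fin n) 0ℓ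
  i ≻⁰ j = c j < c i ⊎ (c i ≡ c j × ¬ W i ∼ W j × toℕ (W j) < toℕ (W i))

  _≋_ : Rel (Fin n) 0ℓ
  i ≋ j = c i ≡ c j × W i ∼ W j

  _≻[_]_ : Fin n → ℕ → Fin n → Set
  i ≻[ zero ] j = i ≻⁰ j
  i ≻[ suc d ] j = i ≻⁰ j ⊎ (i ≋ j × W j ≻[ d ] W i)

  ≻-mono : ∀ d {i j} → i ≻[ d ] j → i ≻[ suc d ] j
  ≻-mono zero i≻j = inj₁ i≻j
  ≻-mono (suc d) (inj₁ i≻j) = inj₁ i≻j
  ≻-mono (suc d) (inj₂ (i≋j , Wj≻Wi)) = inj₂ (i≋j , ≻-mono d Wj≻Wi)

  ≻-unfold : ∀ d {i j} → i ≻[ d ] j → i ≻⁰ j ⊎ (i ≋ j × W j ≻[ d ] W i)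
  ≻-unfold zero i≻j = inj₁ i≻j
  ≻-unfold (suc d) (inj₁ i≻j) = inj₁ i≻j
  ≻-unfold (suc d) (inj₂ (i≋j , Wj≻Wi)) = inj₂ (i≋j , ≻-mono d Wj≻Wi)

  ≋-sym : ∀ {i j} → i ≋ j → j ≋ i
  ≋-sym (ci≡cj , Wi∼Wj) = sym ci≡cj , ∼-sym Wi∼Wj

  ≋-trans : ∀ {i j k} → i ≋ j → j ≋ k → i ≋ k
  ≋-trans (ci≡cj , Wi∼Wj) (cj≡ck , Wj∼Wk) = trans ci≡cj cj≡ck , ∼-trans Wi∼Wj Wj∼Wk

  ≻⁰-irrefl : ∀ {i} → ¬ i ≻⁰ i
  ≻⁰-irrefl (inj₁ ci<ci) = <-irrefl refl ci<ci
  ≻⁰-irrefl (inj₂ (_ , Wi≁Wi , _)) = Wi≁Wi ∼-refl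

  ≻-irrefl : ∀ d {i} → ¬ i ≻[ d ] i
  ≻-irrefl zero = ≻⁰-irrefl
  ≻-irrefl (suc d) (inj₁ i≻i) = ≻⁰-irrefl i≻i
  ≻-irrefl (suc d) (inj₂ (_ , Wi≻Wi)) = ≻-irrefl d Wi≻Wi

  ≻⁰-trans : ∀ {i j k} → i ≻⁰ j → j ≻⁰ k → i ≻⁰ k
  ≻⁰-trans (inj₁ cj<ci) (inj₁ ck<cj) = inj₁ (<-trans ck<cj cj<ci)
  ≻⁰-trans {i} (inj₁ cj<ci) (inj₂ (cj≡ck , _)) = inj₁ (subst (_< c i) cj≡ck cj<ci)
  ≻⁰-trans {k = k} (inj₂ (ci≡cj , _)) (inj₁ ck<cj) = inj₁ (subst (c k <_) (sym ci≡cj) ck<cj)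
  ≻⁰-trans (inj₂ (ci≡cj , Wi≁Wj , Wj<Wi)) (inj₂ (cj≡ck , Wj≁Wk , Wk<Wj)) =
    inj₂ (trans ci≡cj cj≡ck
         , (λ Wi∼Wk → Wj≁Wk (∼-sym (SameBlock-shrink (<⇒≤ (s≤s Wk<Wj)) (<⇒≤ (s≤s Wj<Wi)) (∼-sym Wi∼Wk))))
         , <-trans Wk<Wj Wj<Wi)

  ≻⁰-respʳ : ∀ {i j k} → i ≻⁰ j → j ≋ k → i ≻⁰ k
  ≻⁰-respʳ {i} (inj₁ cj<ci) (cj≡ck , _) = inj₁ (subst (_< c i) cj≡ck cj<ci)
  ≻⁰-respʳ (inj₂ (ci≡cj , Wi≁Wj , Wj<Wi)) (cj≡ck , Wj∼Wk) =
    inj₂ (trans ci≡cj cj≡ck , (λ Wi∼Wk → Wi≁Wj (∼-trans Wi∼Wk (∼-sym Wj∼Wk)))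
         , ∼-separated (Wi≁Wj ∘ ∼-sym) Wj<Wi Wj∼Wk ∼-refl)

  ≻⁰-respˡ : ∀ {i j k} → i ≋ j → j ≻⁰ k → i ≻⁰ k
  ≻⁰-respˡ {k = k} (ci≡cj , _) (inj₁ ck<cj) = inj₁ (subst (c k <_) (sym ci≡cj) ck<cj)
  ≻⁰-respˡ (ci≡cj , Wi∼Wj) (inj₂ (cj≡ck , Wj≁Wk , Wk<Wj)) =
    inj₂ (trans ci≡cj cj≡ck , (λ Wi∼Wk → Wj≁Wk (∼-trans (∼-sym Wi∼Wj) Wi∼Wk))
         , ∼-separated (Wj≁Wk ∘ ∼-sym) Wk<Wj ∼-refl (∼-sym Wi∼Wj))

  ≻-trans : ∀ d {i j k} → i ≻[ d ] j → j ≻[ d ] k → i ≻[ d ] k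
  ≻-trans zero = ≻⁰-trans
  ≻-trans (suc d) (inj₁ i≻j) (inj₁ j≻k) = inj₁ (≻⁰-trans i≻j j≻k)
  ≻-trans (suc d) (inj₁ i≻j) (inj₂ (j≋k , _)) = inj₁ (≻⁰-respʳ i≻j j≋k)
  ≻-trans (suc d) (inj₂ (i≋j , _)) (inj₁ j≻k) = inj₁ (≻⁰-respˡ i≋j j≻k)
  ≻-trans (suc d) (inj₂ (i≋j , Wj≻Wi)) (inj₂ (j≋k , Wk≻Wj)) =
    inj₂ (≋-trans i≋j j≋k , ≻-trans d Wk≻Wj Wj≻Wi)

  ≻-asym : ∀ d {i j} → i ≻[ d ] j → ¬ j ≻[ d ] i
  ≻-asym d i≻j j≻i = ≻-irrefl d (≻-trans d i≻j j≻i)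

  ≻⁰-trichotomy : ∀ {i j} → i ≢ j → i ≻⁰ j ⊎ j ≻⁰ i ⊎ i ≋ j
  ≻⁰-trichotomy {i} {j} i≢j with <-cmp (c i) (c j)
  ... | tri< ci<cj _ _ = inj₂ (inj₁ (inj₁ ci<cj))
  ... | tri> _ _ cj<ci = inj₁ (inj₁ cj<ci)
  ... | tri≈ _ ci≡cj _ with W i ∼? W j
  ...   | yes Wi∼Wj = inj₂ (inj₂ (ci≡cj , Wi∼Wj))
  ...   | no Wi≁Wj with <-cmp (toℕ (W i)) (toℕ (W j))
  ...     | tri< Wi<Wj _ _ = inj₂ (inj₁ (inj₂ (sym ci≡cj , Wi≁Wj ∘ ∼-sym , Wi<Wj)))
  ...     | tri≈ _ Wi≡Wj _ = contradiction (Injection.injective (↔⇒↣ w) (toℕ-injective Wi≡Wj)) i≢j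
  ...     | tri> _ _ Wj<Wi = inj₁ (inj₂ (ci≡cj , Wi≁Wj , Wj<Wi))

  ≻-trichotomy : ∀ d {i j} → i ≢ j → i ∼ j →
                 i ≻[ d ] j ⊎ j ≻[ d ] i ⊎ (∀ m → m ≤ d → w ^ m $ i ∼ w ^ m $ j)
  ≻-trichotomy zero i≢j i∼j with ≻⁰-trichotomy i≢j
  ... | inj₁ i≻j = inj₁ i≻j
  ... | inj₂ (inj₁ j≻i) = inj₂ (inj₁ j≻i)
  ... | inj₂ (inj₂ _) = inj₂ (inj₂ λ { zero _ → i∼j })
  ≻-trichotomy (suc d) {i} {j} i≢j i∼j with ≻⁰-trichotomy i≢j
  ... | inj₁ i≻j = inj₁ (inj₁ i≻j)
  ... | inj₂ (inj₁ j≻i) = inj₂ (inj₁ (inj₁ j≻i))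
  ... | inj₂ (inj₂ i≋j) with ≻-trichotomy d (i≢j ∘ Injection.injective (↔⇒↣ w)) (proj₂ i≋j)
  ...   | inj₁ Wi≻Wj = inj₂ (inj₁ (inj₂ (≋-sym i≋j , Wi≻Wj)))
  ...   | inj₂ (inj₁ Wj≻Wi) = inj₁ (inj₂ (i≋j , Wj≻Wi))
  ...   | inj₂ (inj₂ orbits∼) = inj₂ (inj₂ λ
            { zero _ → i∼j
            ; (suc m) m<d →
                subst₂ _∼_ (sym (^-suc′ w m i)) (sym (^-suc′ w m j)) (orbits∼ m (ℕ.s≤s⁻¹ m<d)) })

  ≻⁰⇒symbol : ∀ π → InJ as π → ∀ {i j} → i ≻⁰ j → symbol π i >ˢ symbol π j
  ≻⁰⇒symbol π π∈J (inj₁ cj<ci) = inj₁ cj<ci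
  ≻⁰⇒symbol π π∈J {i} {j} (inj₂ (ci≡cj , Wi≁Wj , Wj<Wi)) =
    inj₂ (ci≡cj , s≤s (∼-separated (Wi≁Wj ∘ ∼-sym) Wj<Wi (∼-sym (π∈J (W j))) (∼-sym (π∈J (W i)))))

  Sorts : ℕ → Permutation′ n → Set
  Sorts d π = ∀ {i j} → i ∼ j → toℕ (π ⟨$⟩ʳ i) < toℕ (π ⟨$⟩ʳ j) → i ≻[ d ] j

  SymbolDecreasing : Permutation′ n → Set
  SymbolDecreasing π = ∀ {i j} → i ∼ j → toℕ (π ⟨$⟩ʳ i) < toℕ (π ⟨$⟩ʳ j) → symbol π i >ˢ symbol π j

  DecreasingOnBlocks : ColPerm n r → Set
  DecreasingOnBlocks y = ∀ {u v} → toℕ u < toℕ v → u ∼ v → symbolAt y (toℕ u) >ˢ symbolAt y (toℕ v)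

  sorts-reflects : ∀ d π → Sorts d π → ∀ {i j} → i ∼ j → i ≻[ d ] j → toℕ (π ⟨$⟩ʳ i) < toℕ (π ⟨$⟩ʳ j)
  sorts-reflects d π π-sorts {i} {j} i∼j i≻j with <-cmp (toℕ (π ⟨$⟩ʳ i)) (toℕ (π ⟨$⟩ʳ j))
  ... | tri< πi<πj _ _ = πi<πj
  ... | tri≈ _ πi≡πj _ =
    contradiction (subst (i ≻[ d ]_) (sym (Injection.injective (↔⇒↣ π) (toℕ-injective πi≡πj))) i≻j) (≻-irrefl d)
  ... | tri> _ _ πj<πi = contradiction (π-sorts (∼-sym i∼j) πj<πi) (≻-asym d i≻j)

  sorts⇒symbolDecreasing : ∀ d π → InJ as π → Sorts d π → SymbolDecreasing π
  sorts⇒symbolDecreasing d π π∈J π-sorts i∼j πi<πj with ≻-unfold d (π-sorts i∼j πi<πj)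
  ... | inj₁ i≻j = ≻⁰⇒symbol π π∈J i≻j
  ... | inj₂ ((ci≡cj , Wi∼Wj) , Wj≻Wi) =
    inj₂ (ci≡cj , s≤s (sorts-reflects d π π-sorts (∼-sym Wi∼Wj) Wj≻Wi))

  symbolDecreasing⇒¬≻ : ∀ π → InJ as π → SymbolDecreasing π →
                        ∀ d {i j} → i ∼ j → toℕ (π ⟨$⟩ʳ i) < toℕ (π ⟨$⟩ʳ j) → ¬ j ≻[ d ] i
  symbolDecreasing⇒¬≻ π π∈J decreasing zero i∼j πi<πj j≻i =
    >ˢ-asym (decreasing i∼j πi<πj) (≻⁰⇒symbol π π∈J j≻i)
  symbolDecreasing⇒¬≻ π π∈J decreasing (suc d) i∼j πi<πj (inj₁ j≻i) =
    >ˢ-asym (decreasing i∼j πi<πj) (≻⁰⇒symbol π π∈J j≻i)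
  symbolDecreasing⇒¬≻ π π∈J decreasing (suc d) i∼j πi<πj (inj₂ ((cj≡ci , Wj∼Wi) , Wi≻Wj))
    with decreasing i∼j πi<πj
  ... | inj₁ cj<ci = <-irrefl cj≡ci cj<ci
  ... | inj₂ (_ , πWj<πWi) = symbolDecreasing⇒¬≻ π π∈J decreasing d Wj∼Wi (ℕ.s<s⁻¹ πWj<πWi) Wi≻Wj

  sorts-unique : ∀ d π π′ → InJ as π → InJ as π′ → Sorts d π → Sorts d π′ → π ≈ₚ π′
  sorts-unique d π π′ π∈J π′∈J π-sorts π′-sorts k with π ⟨$⟩ʳ k Fin.≟ π′ ⟨$⟩ʳ k
  ... | yes πk≡π′k = πk≡π′k
  ... | no πk≢π′k with inversion π π′ k πk≢π′k
  ...   | i , i′ , πi≡π′i′ , πi<πi′ , π′i′<π′i =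
    ⊥-elim (≻-asym d (π-sorts i∼i′ πi<πi′) (π′-sorts (∼-sym i∼i′) π′i′<π′i))
    where
    i∼i′ : i ∼ i′
    i∼i′ = ∼-trans (∼-sym (π∈J i)) (subst (_∼ i′) (sym πi≡π′i′) (π′∈J i′))

  decreasingOnBlocks⇒symbolDecreasing : ∀ π → InJ as π → DecreasingOnBlocks (act π x) → SymbolDecreasing π
  decreasingOnBlocks⇒symbolDecreasing π π∈J decreasing {i} {j} i∼j πi<πj =
    subst₂ _>ˢ_ (symbolAt-act π i) (symbolAt-act π j) (decreasing πi<πj (InJ-resp-∼ π π∈J i∼j))

  symbolDecreasing⇒decreasingOnBlocks : ∀ π → InJ as π → SymbolDecreasing π → DecreasingOnBlocks (act π x)
  symbolDecreasing⇒decreasingOnBlocks π π∈J decreasing {u} {v} u<v u∼v =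
    subst₂ (λ a b → symbolAt (act π x) (toℕ a) >ˢ symbolAt (act π x) (toℕ b)) (inverseʳ π) (inverseʳ π)
      (subst₂ _>ˢ_ (sym (symbolAt-act π (π ⟨$⟩ˡ u))) (sym (symbolAt-act π (π ⟨$⟩ˡ v)))
        (decreasing (InJ-resp-∼ (flip π) (InJ-flip π π∈J) u∼v)
                    (subst₂ (λ a b → toℕ a < toℕ b) (sym (inverseʳ π)) (sym (inverseʳ π)) u<v)))

  descents⇒decreasingOnBlocks : ∀ {y} → HasDescentsAt as y → DecreasingOnBlocks y
  descents⇒decreasingOnBlocks {y} descents u<v u∼v = descents⇒decreasing {y = y} descents u<v u∼v

  decreasingOnBlocks⇒decreasing : ∀ {y} → DecreasingOnBlocks y →
                                  ∀ {p q} → p < q → q < n → SameBlock as (suc p) (suc q) →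
                                  symbolAt y p >ˢ symbolAt y q
  decreasingOnBlocks⇒decreasing {y} decreasing {p} {q} p<q q<n p~q =
    subst₂ (λ a b → symbolAt y a >ˢ symbolAt y b) toℕ-P toℕ-Q
      (decreasing (subst₂ _<_ (sym toℕ-P) (sym toℕ-Q) p<q)
                  (subst₂ (λ a b → SameBlock as (suc a) (suc b)) (sym toℕ-P) (sym toℕ-Q) p~q))
    where
    P Q : Fin n
    P = fromℕ< (<-trans p<q q<n)
    Q = fromℕ< q<n
    toℕ-P : toℕ P ≡ p
    toℕ-P = toℕ-fromℕ< (<-trans p<q q<n)
    toℕ-Q : toℕ Q ≡ q
    toℕ-Q = toℕ-fromℕ< q<n

  decreasingOnBlocks⇒descents : All (λ a → 1 ≤ a × a ≤ n ∸ 1) as →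
                                ∀ {y} → DecreasingOnBlocks y → HasDescentsAt as y
  decreasingOnBlocks⇒descents bounds {y} decreasing =
    All.tabulate λ a∈as → descentAt a∈as (All.lookup bounds a∈as)
    where
    below : ∀ {a m} → 1 ≤ a → a ≤ m ∸ 1 → a < m
    below {m = zero} 1≤a a≤0 = contradiction (≤-trans 1≤a a≤0) λ ()
    below {m = suc m} _ a≤m = s≤s a≤m
    descentAt : ∀ {a} → a ∈ as → 1 ≤ a × a ≤ n ∸ 1 → IsDescent y a
    descentAt {suc a} a∈as (1≤a , a≤n-1) =
      decreasingOnBlocks⇒decreasing {y} decreasing (n<1+n a) (below 1≤a a≤n-1) (SameBlock-generator a∈as)

  module NoShortCycles (noShortCycles : NoCyclesUpTo (2 * length as) x) where

    K : ℕ
    K = 2 * length as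

    InNonSingletonBlock : Fin n → Set
    InNonSingletonBlock u = ∃ λ v → v ≢ u × v ∼ u

    orbit-leaves-nonSingletonBlocks : ∀ i → ¬ (∀ m → m ≤ K → InNonSingletonBlock (w ^ m $ i))
    orbit-leaves-nonSingletonBlocks i inBlocks =
      orbit-leaves w (nonSingletonPositions as) K (≤-reflexive (length-nonSingletonPositions as)) noShortCycles i
        λ m m≤K → let (v , v≢u , v∼u) = inBlocks m m≤K in SameBlock⇒nonSingleton v∼u (v≢u ∘ toℕ-injective)

    ≻-total : ∀ {i j} → i ≢ j → i ∼ j → i ≻[ K ] j ⊎ j ≻[ K ] i
    ≻-total {i} {j} i≢j i∼j with ≻-trichotomy K i≢j i∼j
    ... | inj₁ i≻j = inj₁ i≻j
    ... | inj₂ (inj₁ j≻i) = inj₂ j≻i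
    ... | inj₂ (inj₂ orbits∼) = ⊥-elim (orbit-leaves-nonSingletonBlocks i λ m m≤K →
            w ^ m $ j , i≢j ∘ sym ∘ ^-injective w m , ∼-sym (orbits∼ m m≤K))

    act-free : ∀ π π′ → InJ as π → InJ as π′ → act π x ≈ act π′ x → π ≈ₚ π′
    act-free π π′ π∈J π′∈J (ω≈ , _) k with π ⟨$⟩ʳ k Fin.≟ π′ ⟨$⟩ʳ k
    ... | yes πk≡π′k = πk≡π′k
    ... | no πk≢π′k = ⊥-elim (orbit-leaves-nonSingletonBlocks k λ m _ → σ (w ^ m $ k) , moved m , σ∼ _)
      where
      σ : Fin n → Fin n
      σ a = π′ ⟨$⟩ˡ (π ⟨$⟩ʳ a)

      σ∼ : ∀ a → σ a ∼ a
      σ∼ a = ∼-trans (InJ-flip π′ π′∈J (π ⟨$⟩ʳ a)) (π∈J a)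

      σ-comm : ∀ a → σ (W a) ≡ W (σ a)
      σ-comm a = begin
        π′ ⟨$⟩ˡ (π ⟨$⟩ʳ W a)                    ≡⟨ cong (λ b → π′ ⟨$⟩ˡ (π ⟨$⟩ʳ W b)) (inverseˡ π) ⟨
        π′ ⟨$⟩ˡ (π ⟨$⟩ʳ W (π ⟨$⟩ˡ (π ⟨$⟩ʳ a))) ≡⟨ cong (π′ ⟨$⟩ˡ_) (ω≈ (π ⟨$⟩ʳ a)) ⟩
        π′ ⟨$⟩ˡ (π′ ⟨$⟩ʳ W (σ a))               ≡⟨ inverseˡ π′ ⟩
        W (σ a)                                  ∎

      σ-^ : ∀ m a → σ (w ^ m $ a) ≡ w ^ m $ σ a
      σ-^ zero a = refl
      σ-^ (suc m) a = trans (σ-comm _) (cong W (σ-^ m a))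

      moved : ∀ m → σ (w ^ m $ k) ≢ w ^ m $ k
      moved m σwᵐk≡wᵐk = πk≢π′k (sym (trans (cong (π′ ⟨$⟩ʳ_) (sym σk≡k)) (inverseʳ π′)))
        where
        σk≡k : σ k ≡ k
        σk≡k = ^-injective w m (trans (sym (σ-^ m k)) σwᵐk≡wᵐk)

    descents⇒sorts : ∀ π → InJ as π → HasDescentsAt as (act π x) → Sorts K π
    descents⇒sorts π π∈J descents i∼j πi<πj with ≻-total (λ { refl → <-irrefl refl πi<πj }) i∼j
    ... | inj₁ i≻j = i≻j
    ... | inj₂ j≻i = ⊥-elim (symbolDecreasing⇒¬≻ π π∈J decreasing K i∼j πi<πj j≻i)
      where
      decreasing : SymbolDecreasing π
      decreasing = decreasingOnBlocks⇒symbolDecreasing π π∈J (descents⇒decreasingOnBlocks descents)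

    sorts⇒descents : All (λ a → 1 ≤ a × a ≤ n ∸ 1) as →
                     ∀ π → InJ as π → Sorts K π → HasDescentsAt as (act π x)
    sorts⇒descents bounds π π∈J π-sorts = decreasingOnBlocks⇒descents bounds
      (symbolDecreasing⇒decreasingOnBlocks π π∈J (sorts⇒symbolDecreasing K π π∈J π-sorts))

    sorting : Σ (Permutation′ n) λ π → InJ as π × Sorts K π
    sorting with BlockSort.blockSort ∼-isDecEquivalence (≻-trans K) ≻-total
    ... | ρ , ρ∈J , ρ-sorted = flip ρ , InJ-flip ρ ρ∈J , λ i∼j ρ⁻¹i<ρ⁻¹j →
      subst₂ _≻[ K ]_ (inverseʳ ρ) (inverseʳ ρ)
        (ρ-sorted _ _ ρ⁻¹i<ρ⁻¹j (InJ-resp-∼ (flip ρ) (InJ-flip ρ ρ∈J) i∼j))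

lemma3p10 : (n r : ℕ) .{{_ : NonZero r}} (as : List ℕ)
            → All (λ a → 1 ≤ a × a ≤ n ∸ 1) as
            → (x : ColPerm n r)
            → NoCyclesUpTo (2 * length as) x
            → (∀ π π′ → InJ as π → InJ as π′ → act π x ≈ act π′ x → π ≈ₚ π′)
              × Σ (Permutation′ n) (λ π → InJ as π × HasDescentsAt as (act π x)
                  × (∀ π′ → InJ as π′ → HasDescentsAt as (act π′ x) → act π′ x ≈ act π x))
lemma3p10 n r as bounds x noShortCycles with ConjugationAction.NoShortCycles.sorting as x noShortCycles
... | π , π∈J , π-sorts =
  act-free , π , π∈J , sorts⇒descents bounds π π∈J π-sorts ,
  λ π′ π′∈J π′-descents →
    act-cong π′ π (sorts-unique K π′ π π′∈J π∈J (descents⇒sorts π′ π′∈J π′-descents) π-sorts)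
  where
  open ConjugationAction as x
  open NoShortCycles noShortCycles
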